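{- Let $G=(V,E)$ be a nonempty finite graph in which every vertex carries a loop, let $f$ be an optimal opinion function of $G$, and let $H$ be the graph obtained from $G$ by deleting $k$ non-loop edges, where $k=l+s+m$: $l$ of the deleted edges join two vertices with $f$-opinion $+1$, $s$ of them join two vertices with $f$-opinion $-1$, and the remaining $m$ join a vertex with opinion $+1$ and a vertex with opinion $-1$. Then $$-4l-2m\le \gamma(G)-\gamma(H)\le 2k.$$
   Context: All graphs are finite with vertex set $V$, $|V|=n$, and every vertex has a loop. For $v\in V$, the neighborhood $N_v=\{w\in V:(v,w)\in E\}$ contains $v$ itself. An opinion function is a map $f:V\to\{ -1,1\}$ (opinion $+1$ is "for", $-1$ is "against"), extended to subsets by $f(W)=\sum_{w\in W}f(w)$. $V^+=\{v\in V: f(N_v)>0\}$. The opinion function $f$ is strictly majoritarian on the graph if $|V^+|>|V|/2$. The strict domination number is $\gamma(G)=\min\{f(V): f \text{ strictly majoritarian on } G\}$, and an opinion function of a graph is optimal if it is strictly majoritarian on that graph and $f(V)$ equals its strict domination number. -}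

module Defs where

open import Data.Bool using (Bool; true; false; _∧_; _∨_; not; if_then_else_)
open import Data.Nat as ℕ using (ℕ; zero; suc)
open import Data.Fin using (Fin; zero; suc)
open import Data.Fin.Properties using (_≟_)
open import Data.Integer as ℤ using (ℤ; +_; 0ℤ; 1ℤ; -1ℤ; _<?_)
open import Data.List using (List; []; _∷_; length)
open import Data.Bool.ListAction using (any)
open import Data.List.Relation.Unary.All using (All)
open import Data.List.Relation.Unary.AllPairs using (AllPairs)
open import Data.Product using (_×_; _,_; proj₁; proj₂; Σ)
open import Data.Sum using (_⊎_)
open import Relation.Binary.PropositionalEquality using (_≡_)
open import Relation.Nullary using (¬_; Dec; yes; no)
open import Relation.Nullary.Decidable using (⌊_⌋)

Graph : ℕ → Set
Graph n = Fin n → Fin n → Bool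

record IsLoopedGraph {n : ℕ} (G : Graph n) : Set where
  field
    symmetric : ∀ v w → G v w ≡ G w v
    loops     : ∀ v → G v v ≡ true

-- Opinion function: true = +1 ("for"), false = -1 ("against").
Opinion : ℕ → Set
Opinion n = Fin n → Bool

val : Bool → ℤ
val true  = 1ℤ
val false = -1ℤ

sumFin : {n : ℕ} → (Fin n → ℤ) → ℤ
sumFin {zero}  g = 0ℤ
sumFin {suc n} g = g zero ℤ.+ sumFin (λ i → g (suc i))

countFin : {n : ℕ} → (Fin n → Bool) → ℕ
countFin {zero}  p = 0
countFin {suc n} p = (if p zero then 1 else 0) ℕ.+ countFin (λ i → p (suc i))

total : {n : ℕ} → Opinion n → ℤ
total f = sumFin (λ w → val (f w))

nbhdSum : {n : ℕ} → Graph n → Opinion n → Fin n → ℤ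
nbhdSum G f v = sumFin (λ w → if G v w then val (f w) else 0ℤ)

posCount : {n : ℕ} → Graph n → Opinion n → ℕ
posCount G f = countFin (λ v → ⌊ 0ℤ <? nbhdSum G f v ⌋)

-- strictly majoritarian: |V⁺| > |V|/2, i.e. 2|V⁺| > n
StrictlyMajoritarian : {n : ℕ} → Graph n → Opinion n → Set
StrictlyMajoritarian {n} G f = n ℕ.< 2 ℕ.* posCount G f

IsStrictDomNumber : {n : ℕ} → Graph n → ℤ → Set
IsStrictDomNumber G g =
  Σ (Opinion _) (λ f → StrictlyMajoritarian G f × total f ≡ g)
  × (∀ f → StrictlyMajoritarian G f → g ℤ.≤ total f)

Optimal : {n : ℕ} → Graph n → Opinion n → Set
Optimal G f = StrictlyMajoritarian G f
            × (∀ g → IsStrictDomNumber G g → total f ≡ g)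

-- Edges are given as ordered pairs; an undirected edge {a,b}.
Edge : ℕ → Set
Edge n = Fin n × Fin n

SameEdge : {n : ℕ} → Edge n → Edge n → Set
SameEdge (a , b) (c , d) = (a ≡ c × b ≡ d) ⊎ (a ≡ d × b ≡ c)

ValidDeletion : {n : ℕ} → Graph n → List (Edge n) → Set
ValidDeletion G D =
  All (λ e → ¬ (proj₁ e ≡ proj₂ e) × G (proj₁ e) (proj₂ e) ≡ true) D
  × AllPairs (λ e e' → ¬ SameEdge e e') D

matches : {n : ℕ} → Fin n → Fin n → Edge n → Bool
matches u v (a , b) = (⌊ a ≟ u ⌋ ∧ ⌊ b ≟ v ⌋) ∨ (⌊ a ≟ v ⌋ ∧ ⌊ b ≟ u ⌋)

deleteEdges : {n : ℕ} → Graph n → List (Edge n) → Graph n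
deleteEdges G D u v = G u v ∧ not (any (matches u v) D)

countList : {A : Set} → (A → Bool) → List A → ℕ
countList p []       = 0
countList p (x ∷ xs) = (if p x then 1 else 0) ℕ.+ countList p xs

countPP countMM countPM : {n : ℕ} → Opinion n → List (Edge n) → ℕ
countPP f D = countList (λ e → f (proj₁ e) ∧ f (proj₂ e)) D
countMM f D = countList (λ e → not (f (proj₁ e)) ∧ not (f (proj₂ e))) D
countPM f D = countList (λ e → (f (proj₁ e) ∧ not (f (proj₂ e)))
                                  ∨ (not (f (proj₁ e)) ∧ f (proj₂ e))) D

-- Persuading a single opponent w (turning f(w) into +1) raises f(V) by 2 and raises f(N_v) by 2
-- for every neighbour v of w, w itself included since it carries a loop. Deleting the edge ab
-- lowers f(N_a) by f(b) and f(N_b) by f(a) and changes no other neighbourhood sum.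
--
-- Upper bound: put the deleted edges back into H one at a time, starting from an optimal
-- function of H. An edge ab can only hurt an endpoint whose partner is against; persuading that
-- partner repairs both endpoints, so every edge costs at most 2.
--
-- Lower bound: start from the optimal function f of G. After the deletion, a vertex v is short of
-- one unit of f(N_v) for every deleted edge joining it to a vertex of opinion +1; these units
-- number 2l + m. Each unit is paid for by persuading an opponent in the current neighbourhood of
-- v in H, and if there is none then v is already positive. Each unit thus costs at most 2.

module Submission where

open import Data.Bool using (Bool; true; false; T; _∧_; _∨_; not; if_then_else_)
open import Data.Bool.Properties using (∧-comm; ∧-identityʳ; T-∧) renaming (_≟_ to _≟ᵇ_)
open import Data.Empty using (⊥-elim)
open import Data.Fin using (Fin; zero; suc)
open import Data.Fin.Properties using (_≟_; any?)
open import Data.Integer using (ℤ; +_; -_; _-_; _+_; _≤_; _<_; 0ℤ; 1ℤ; _<?_; +≤+; -≤+)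
import Data.Integer.Properties as ℤₚ
open import Data.Integer.Tactic.RingSolver using (solve-∀)
open import Data.Nat.Tactic.RingSolver using () renaming (solve-∀ to ℕsolve-∀)
open import Data.List using (List; []; _∷_; length)
open import Data.List.Relation.Unary.All as All using (All; []; _∷_)
open import Data.Nat as ℕ using (ℕ; zero; suc; z≤n; s≤s)
import Data.Nat.Properties as ℕₚ
open import Data.Product using (_×_; _,_; proj₁; proj₂; ∃)
open import Data.Sum using (_⊎_; inj₁; inj₂; map₁)
open import Data.Vec.Functional using (updateAt)
open import Data.Vec.Functional.Properties using (updateAt-updates; updateAt-minimal)
open import Function using (_∘_; const)
open import Function.Bundles using (Equivalence)
open import Relation.Binary.PropositionalEquality
open import Relation.Nullary using (¬_; yes; no)
open import Relation.Nullary.Decidable using (⌊_⌋; _×-dec_; toWitness; fromWitness; ⌊⌋-map′)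

open import Defs

private
  variable
    n : ℕ

0≤j⇒i≤i+j : ∀ i {j} → 0ℤ ≤ j → i ≤ i + j
0≤j⇒i≤i+j i 0≤j = subst (_≤ i + _) (ℤₚ.+-identityʳ i) (ℤₚ.+-monoʳ-≤ i 0≤j)

≤-+-trans : ∀ {i j k c d} → i ≤ j + d → j ≤ k + c → i ≤ k + (c + d)
≤-+-trans {k = k} {c} {d} i≤j+d j≤k+c =
  ℤₚ.≤-trans i≤j+d (ℤₚ.≤-trans (ℤₚ.+-monoˡ-≤ d j≤k+c) (ℤₚ.≤-reflexive (ℤₚ.+-assoc k c d)))

pos-2*suc : ∀ m → + (2 ℕ.* suc m) ≡ + 2 + + (2 ℕ.* m)
pos-2*suc m = trans (cong +_ (ℕₚ.*-suc 2 m)) (ℤₚ.pos-+ 2 (2 ℕ.* m))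

i≤j+k⇒i-j≤k : ∀ {i j k} → i ≤ j + k → i - j ≤ k
i≤j+k⇒i-j≤k {i} {j} {k} i≤j+k = ℤₚ.≤-trans (ℤₚ.+-monoˡ-≤ (- j) i≤j+k) (ℤₚ.≤-reflexive (cancel j k))
  where
  cancel : ∀ j k → j + k + - j ≡ k
  cancel = solve-∀

j≤i+k⇒-k≤i-j : ∀ {i j k} → j ≤ i + k → - k ≤ i - j
j≤i+k⇒-k≤i-j {i} {j} {k} j≤i+k =
  ℤₚ.≤-trans (ℤₚ.≤-reflexive (sym (cancel i k))) (ℤₚ.+-monoʳ-≤ i (ℤₚ.neg-mono-≤ j≤i+k))
  where
  cancel : ∀ i k → i + - (i + k) ≡ - k
  cancel = solve-∀

𝟙 : Bool → ℤ
𝟙 true  = 1ℤ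
𝟙 false = 0ℤ

summand : Bool → Bool → ℤ
summand adjacent opinion = if adjacent then val opinion else 0ℤ

sumFin-cong : {g g′ : Fin n → ℤ} → (∀ w → g w ≡ g′ w) → sumFin g ≡ sumFin g′
sumFin-cong {zero}  eq = refl
sumFin-cong {suc n} eq = cong₂ _+_ (eq zero) (sumFin-cong (eq ∘ suc))

sumFin-mono : {g g′ : Fin n → ℤ} → (∀ w → g w ≤ g′ w) → sumFin g ≤ sumFin g′
sumFin-mono {zero}  le = ℤₚ.≤-refl
sumFin-mono {suc n} le = ℤₚ.+-mono-≤ (le zero) (sumFin-mono (le ∘ suc))

sumFin-+ : (g g′ : Fin n → ℤ) → sumFin (λ w → g w + g′ w) ≡ sumFin g + sumFin g′
sumFin-+ {zero}  g g′ = refl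
sumFin-+ {suc n} g g′ = begin
  g zero + g′ zero + sumFin (λ w → g (suc w) + g′ (suc w))
    ≡⟨ cong (_+_ (g zero + g′ zero)) (sumFin-+ (g ∘ suc) (g′ ∘ suc)) ⟩
  g zero + g′ zero + (sumFin (g ∘ suc) + sumFin (g′ ∘ suc))
    ≡⟨ interchange (g zero) (g′ zero) _ _ ⟩
  g zero + sumFin (g ∘ suc) + (g′ zero + sumFin (g′ ∘ suc)) ∎
  where
  open ≡-Reasoning
  interchange : ∀ a b c d → a + b + (c + d) ≡ a + c + (b + d)
  interchange = solve-∀

sumFin-0 : sumFin {n} (const 0ℤ) ≡ 0ℤ
sumFin-0 {zero}  = refl
sumFin-0 {suc n} = trans (ℤₚ.+-identityˡ _) (sumFin-0 {n})

sumFin-at : (x : Fin n) (g : Fin n → ℤ) → sumFin (λ w → if ⌊ x ≟ w ⌋ then g w else 0ℤ) ≡ g x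
sumFin-at {suc n} zero    g = trans (cong (_+_ (g zero)) (sumFin-0 {n})) (ℤₚ.+-identityʳ (g zero))
-- ⌊_⌋ is isYes, which does not compute through the map′ in the definition of suc x ≟ suc w.
sumFin-at {suc n} (suc x) g = begin
  0ℤ + sumFin (λ w → if ⌊ suc x ≟ suc w ⌋ then g (suc w) else 0ℤ)
    ≡⟨ cong (_+_ 0ℤ) (sumFin-cong λ w → cong (λ b → if b then g (suc w) else 0ℤ) (⌊⌋-map′ _ _ (x ≟ w))) ⟩
  0ℤ + sumFin (λ w → if ⌊ x ≟ w ⌋ then g (suc w) else 0ℤ)
    ≡⟨ cong (_+_ 0ℤ) (sumFin-at x (g ∘ suc)) ⟩
  0ℤ + g (suc x)
    ≡⟨ ℤₚ.+-identityˡ (g (suc x)) ⟩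
  g (suc x) ∎
  where open ≡-Reasoning

countFin-mono : {p q : Fin n → Bool} → (∀ v → T (p v) → T (q v)) → countFin p ℕ.≤ countFin q
countFin-mono {zero}              p⇒q = z≤n
countFin-mono {suc n} {p} {q} p⇒q with p zero | q zero | p⇒q zero
... | true  | true  | _    = s≤s (countFin-mono (p⇒q ∘ suc))
... | true  | false | p⇒q₀ = ⊥-elim (p⇒q₀ _)
... | false | true  | _    = ℕₚ.m≤n⇒m≤1+n (countFin-mono (p⇒q ∘ suc))
... | false | false | _    = countFin-mono (p⇒q ∘ suc)

majority-transfer : {K K′ : Graph n} {h h′ : Opinion n} →
                    (∀ v → 0ℤ < nbhdSum K h v → 0ℤ < nbhdSum K′ h′ v) →
                    StrictlyMajoritarian K h → StrictlyMajoritarian K′ h′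
majority-transfer {K = K} {h = h} pos⇒pos maj =
  ℕₚ.<-≤-trans maj (ℕₚ.*-monoʳ-≤ 2 (countFin-mono λ v pos →
    fromWitness (pos⇒pos v (toWitness {a? = 0ℤ <? nbhdSum K h v} pos))))

persuade : Opinion n → Fin n → Opinion n
persuade h x = updateAt h x (const true)

persuade-self : (h : Opinion n) (x : Fin n) → persuade h x x ≡ true
persuade-self h x = updateAt-updates x h

val-persuade : (h : Opinion n) {x : Fin n} → h x ≡ false →
               ∀ w → val (persuade h x w) ≡ val (h w) + (if ⌊ x ≟ w ⌋ then + 2 else 0ℤ)
val-persuade h {x} hx w with x ≟ w
... | yes refl rewrite persuade-self h x | hx = refl
... | no x≢w   rewrite updateAt-minimal w x {const true} h (x≢w ∘ sym) = sym (ℤₚ.+-identityʳ _)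

total-persuade : (h : Opinion n) {x : Fin n} → h x ≡ false → total (persuade h x) ≡ total h + + 2
total-persuade h {x} hx = begin
  total (persuade h x)
    ≡⟨ sumFin-cong (val-persuade h hx) ⟩
  sumFin (λ w → val (h w) + (if ⌊ x ≟ w ⌋ then + 2 else 0ℤ))
    ≡⟨ sumFin-+ (val ∘ h) _ ⟩
  total h + sumFin (λ w → if ⌊ x ≟ w ⌋ then + 2 else 0ℤ)
    ≡⟨ cong (_+_ (total h)) (sumFin-at x (const (+ 2))) ⟩
  total h + + 2 ∎
  where open ≡-Reasoning

nbhdSum-persuade : (h : Opinion n) {x : Fin n} → h x ≡ false → ∀ (K : Graph n) v →
                   nbhdSum K (persuade h x) v ≡ nbhdSum K h v + (if K v x then + 2 else 0ℤ)
nbhdSum-persuade h {x} hx K v = begin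
  nbhdSum K (persuade h x) v
    ≡⟨ sumFin-cong summand-persuade ⟩
  sumFin (λ w → summand (K v w) (h w) + (if ⌊ x ≟ w ⌋ then (if K v w then + 2 else 0ℤ) else 0ℤ))
    ≡⟨ sumFin-+ (λ w → summand (K v w) (h w)) _ ⟩
  nbhdSum K h v + sumFin (λ w → if ⌊ x ≟ w ⌋ then (if K v w then + 2 else 0ℤ) else 0ℤ)
    ≡⟨ cong (_+_ (nbhdSum K h v)) (sumFin-at x (λ w → if K v w then + 2 else 0ℤ)) ⟩
  nbhdSum K h v + (if K v x then + 2 else 0ℤ) ∎
  where
  open ≡-Reasoning
  summand-persuade : ∀ w → summand (K v w) (persuade h x w)
                         ≡ summand (K v w) (h w) + (if ⌊ x ≟ w ⌋ then (if K v w then + 2 else 0ℤ) else 0ℤ)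
  summand-persuade w with K v w
  ... | true  = val-persuade h hx w
  ... | false with x ≟ w
  ...   | yes _ = refl
  ...   | no _  = refl

0≤if-then-2 : ∀ k → 0ℤ ≤ (if k then + 2 else 0ℤ)
0≤if-then-2 true  = +≤+ z≤n
0≤if-then-2 false = +≤+ z≤n

nbhdSum-persuade-mono : (h : Opinion n) {x : Fin n} → h x ≡ false → ∀ (K : Graph n) v →
                        nbhdSum K h v ≤ nbhdSum K (persuade h x) v
nbhdSum-persuade-mono h hx K v =
  subst (nbhdSum K h v ≤_) (sym (nbhdSum-persuade h hx K v)) (0≤j⇒i≤i+j (nbhdSum K h v) (0≤if-then-2 (K v _)))

-- The term h(b) that the edge ab contributes to h(N_a); it is zero at every v ≠ a.
viaEdge : Graph n → Opinion n → Fin n → Fin n → Fin n → ℤ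
viaEdge K h a b v = summand (⌊ a ≟ v ⌋ ∧ K v b) (h b)

record EdgeDeleted (K K′ : Graph n) (a b : Fin n) : Set where
  field
    nbhdSum-split : ∀ h v → nbhdSum K h v ≡ nbhdSum K′ h v + (viaEdge K h a b v + viaEdge K h b a v)
open EdgeDeleted

EdgeDeleted-sym : {K K′ : Graph n} {a b : Fin n} → EdgeDeleted K K′ a b → EdgeDeleted K K′ b a
EdgeDeleted-sym {K = K} {K′} {a} {b} del .nbhdSum-split h v =
  trans (nbhdSum-split del h v) (cong (_+_ (nbhdSum K′ h v)) (ℤₚ.+-comm (viaEdge K h a b v) (viaEdge K h b a v)))

summand-split : ∀ k m₁ m₂ y → ¬ (T m₁ × T m₂) →
                summand k y ≡ summand (k ∧ not (m₁ ∨ m₂)) y + (summand (k ∧ m₁) y + summand (k ∧ m₂) y)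
summand-split false m₁    m₂    y     _    = refl
summand-split true  true  true  y     excl = ⊥-elim (excl _)
summand-split true  false false true  _    = refl
summand-split true  false false false _    = refl
summand-split true  true  false true  _    = refl
summand-split true  true  false false _    = refl
summand-split true  false true  true  _    = refl
summand-split true  false true  false _    = refl

summand-∧-∧ : ∀ k c d y → summand (k ∧ (c ∧ d)) y ≡ (if d then summand (c ∧ k) y else 0ℤ)
summand-∧-∧ false false false y = refl
summand-∧-∧ false false true  y = refl
summand-∧-∧ false true  false y = refl
summand-∧-∧ false true  true  y = refl
summand-∧-∧ true  false false y = refl
summand-∧-∧ true  false true  y = refl
summand-∧-∧ true  true  false y = refl
summand-∧-∧ true  true  true  y = refl

∧-not-∨ : ∀ g m A → g ∧ not (m ∨ A) ≡ (g ∧ not A) ∧ not m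
∧-not-∨ false m     A     = refl
∧-not-∨ true  true  true  = refl
∧-not-∨ true  true  false = refl
∧-not-∨ true  false true  = refl
∧-not-∨ true  false false = refl

deleteEdges-∷ : (G : Graph n) (e : Edge n) (D : List (Edge n)) →
                ∀ v w → deleteEdges G (e ∷ D) v w ≡ deleteEdges G D v w ∧ not (matches v w e)
deleteEdges-∷ G e D v w = ∧-not-∨ (G v w) (matches v w e) _

matches-exclusive : {a b v w : Fin n} → a ≢ b →
                    ¬ (T (⌊ a ≟ v ⌋ ∧ ⌊ b ≟ w ⌋) × T (⌊ a ≟ w ⌋ ∧ ⌊ b ≟ v ⌋))
matches-exclusive {a = a} {b} {v} {w} a≢b (p , q) =
  a≢b (trans (toWitness {a? = a ≟ w} a≡w) (sym (toWitness {a? = b ≟ w} b≡w)))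
  where
  b≡w = proj₂ (Equivalence.to T-∧ p)
  a≡w = proj₁ (Equivalence.to T-∧ q)

deleteEdges-EdgeDeleted : (G : Graph n) (D : List (Edge n)) {a b : Fin n} → a ≢ b →
                          EdgeDeleted (deleteEdges G D) (deleteEdges G ((a , b) ∷ D)) a b
deleteEdges-EdgeDeleted G D {a} {b} a≢b .nbhdSum-split h v = begin
  nbhdSum K h v
    ≡⟨ sumFin-cong split ⟩
  sumFin (λ w → summand (K′ v w) (h w) + (near₁ w + near₂ w))
    ≡⟨ sumFin-+ (λ w → summand (K′ v w) (h w)) _ ⟩
  nbhdSum K′ h v + sumFin (λ w → near₁ w + near₂ w)
    ≡⟨ cong (_+_ (nbhdSum K′ h v)) (trans (sumFin-+ near₁ near₂) (cong₂ _+_ sum-near₁ sum-near₂)) ⟩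
  nbhdSum K′ h v + (viaEdge K h a b v + viaEdge K h b a v) ∎
  where
  open ≡-Reasoning
  K K′ : Graph _
  K  = deleteEdges G D
  K′ = deleteEdges G ((a , b) ∷ D)
  near₁ near₂ : Fin _ → ℤ
  near₁ w = summand (K v w ∧ (⌊ a ≟ v ⌋ ∧ ⌊ b ≟ w ⌋)) (h w)
  near₂ w = summand (K v w ∧ (⌊ a ≟ w ⌋ ∧ ⌊ b ≟ v ⌋)) (h w)
  split : ∀ w → summand (K v w) (h w) ≡ summand (K′ v w) (h w) + (near₁ w + near₂ w)
  split w = trans (summand-split (K v w) _ _ (h w) (matches-exclusive a≢b))
                  (cong (λ k → summand k (h w) + (near₁ w + near₂ w)) (sym (deleteEdges-∷ G (a , b) D v w)))
  sum-near₁ : sumFin near₁ ≡ viaEdge K h a b v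
  sum-near₁ = trans (sumFin-cong λ w → summand-∧-∧ (K v w) ⌊ a ≟ v ⌋ ⌊ b ≟ w ⌋ (h w))
                    (sumFin-at b (λ w → summand (⌊ a ≟ v ⌋ ∧ K v w) (h w)))
  sum-near₂ : sumFin near₂ ≡ viaEdge K h b a v
  sum-near₂ = trans (sumFin-cong λ w →
                       trans (cong (λ c → summand (K v w ∧ c) (h w)) (∧-comm ⌊ a ≟ w ⌋ ⌊ b ≟ v ⌋))
                             (summand-∧-∧ (K v w) ⌊ b ≟ v ⌋ ⌊ a ≟ w ⌋ (h w)))
                    (sumFin-at a (λ w → summand (⌊ b ≟ v ⌋ ∧ K v w) (h w)))

deleteEdges-[] : (G : Graph n) → ∀ h v → nbhdSum (deleteEdges G []) h v ≡ nbhdSum G h v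
deleteEdges-[] G h v = sumFin-cong λ w → cong (λ k → summand k (h w)) (∧-identityʳ (G v w))

matches-diag : {a b : Fin n} → a ≢ b → ∀ v → matches v v (a , b) ≡ false
matches-diag {a = a} {b} a≢b v with a ≟ v | b ≟ v
... | yes refl | yes refl = ⊥-elim (a≢b refl)
... | yes _    | no _     = refl
... | no _     | _        = refl

deleteEdges-loops : {G : Graph n} → (∀ v → G v v ≡ true) →
                    {D : List (Edge n)} → All (λ e → proj₁ e ≢ proj₂ e) D → ∀ v → deleteEdges G D v v ≡ true
deleteEdges-loops {G = G} loops []                    v = trans (∧-identityʳ (G v v)) (loops v)
deleteEdges-loops {G = G} loops {(a , b) ∷ D} (a≢b ∷ nl) v =
  trans (deleteEdges-∷ G (a , b) D v v)
        (cong₂ _∧_ (deleteEdges-loops {G = G} loops nl v) (cong not (matches-diag a≢b v)))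

summand-true-nonneg : ∀ c → 0ℤ ≤ summand c true
summand-true-nonneg true  = +≤+ z≤n
summand-true-nonneg false = +≤+ z≤n

0≤2+summand : ∀ c y → 0ℤ ≤ + 2 + summand c y
0≤2+summand true  true  = +≤+ z≤n
0≤2+summand true  false = +≤+ z≤n
0≤2+summand false y     = +≤+ z≤n

viaEdge-nonneg : (K : Graph n) (h : Opinion n) (a : Fin n) {b : Fin n} → h b ≡ true →
                 ∀ v → 0ℤ ≤ viaEdge K h a b v
viaEdge-nonneg K h a {b} hb v =
  subst (λ y → 0ℤ ≤ summand (⌊ a ≟ v ⌋ ∧ K v b) y) (sym hb) (summand-true-nonneg _)

loop-gain-covers-loss : {K K′ : Graph n} → (∀ v → K′ v v ≡ true) →
                        ∀ (h : Opinion n) a b v → 0ℤ ≤ (if K′ v b then + 2 else 0ℤ) + viaEdge K h b a v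
loop-gain-covers-loss {K = K} {K′} loops h a b v with b ≟ v
... | yes refl rewrite loops b = 0≤2+summand (K b a) (h a)
... | no _ = subst (0ℤ ≤_) (sym (ℤₚ.+-identityʳ _)) (0≤if-then-2 (K′ v b))

-- Persuaded, b gains 2 through its loop, more than the 1 it can lose with the edge; a loses nothing.
persuade-restores : {K K′ : Graph n} {a b : Fin n} → (∀ v → K′ v v ≡ true) → EdgeDeleted K K′ a b →
                    ∀ h → h b ≡ false → ∀ v → nbhdSum K′ h v ≤ nbhdSum K (persuade h b) v
persuade-restores {K = K} {K′} {a} {b} loops del h hb v = begin
  nbhdSum K′ h v
    ≤⟨ 0≤j⇒i≤i+j _ (ℤₚ.+-mono-≤ (loop-gain-covers-loss {K = K} {K′} loops h′ a b v)
                               (viaEdge-nonneg K h′ a (persuade-self h b) v)) ⟩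
  nbhdSum K′ h v + (gain + viaEdge K h′ b a v + viaEdge K h′ a b v)
    ≡⟨ regroup (nbhdSum K′ h v) gain _ _ ⟩
  nbhdSum K′ h v + gain + (viaEdge K h′ a b v + viaEdge K h′ b a v)
    ≡⟨ cong (_+ (viaEdge K h′ a b v + viaEdge K h′ b a v)) (sym (nbhdSum-persuade h hb K′ v)) ⟩
  nbhdSum K′ h′ v + (viaEdge K h′ a b v + viaEdge K h′ b a v)
    ≡⟨ sym (nbhdSum-split del h′ v) ⟩
  nbhdSum K h′ v ∎
  where
  open ℤₚ.≤-Reasoning
  h′ = persuade h b
  gain = if K′ v b then + 2 else 0ℤ
  regroup : ∀ x g p q → x + (g + p + q) ≡ x + g + (q + p)
  regroup = solve-∀

restore-edge : {K K′ : Graph n} {a b : Fin n} → (∀ v → K′ v v ≡ true) → EdgeDeleted K K′ a b →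
               ∀ h → ∃ λ h′ → (∀ v → nbhdSum K′ h v ≤ nbhdSum K h′ v) × total h′ ≤ total h + + 2
restore-edge {K = K} {K′} {a} {b} loops del h with h b in hb | h a in ha
... | false | _     = persuade h b , persuade-restores loops del h hb ,
                      ℤₚ.≤-reflexive (total-persuade h hb)
... | true  | false = persuade h a , persuade-restores loops (EdgeDeleted-sym del) h ha ,
                      ℤₚ.≤-reflexive (total-persuade h ha)
... | true  | true  = h , edge-harmless , 0≤j⇒i≤i+j _ (+≤+ z≤n)
  where
  edge-harmless : ∀ v → nbhdSum K′ h v ≤ nbhdSum K h v
  edge-harmless v = subst (nbhdSum K′ h v ≤_) (sym (nbhdSum-split del h v))
                          (0≤j⇒i≤i+j _ (ℤₚ.+-mono-≤ (viaEdge-nonneg K h a hb v) (viaEdge-nonneg K h b ha v)))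

restore : {G : Graph n} → (∀ v → G v v ≡ true) → {D : List (Edge n)} → All (λ e → proj₁ e ≢ proj₂ e) D →
          ∀ h → ∃ λ h′ → (∀ v → nbhdSum (deleteEdges G D) h v ≤ nbhdSum G h′ v)
                       × total h′ ≤ total h + + (2 ℕ.* length D)
restore {G = G} loops [] h = h , (λ v → ℤₚ.≤-reflexive (deleteEdges-[] G h v)) , 0≤j⇒i≤i+j _ (+≤+ z≤n)
restore {G = G} loops {(a , b) ∷ D} (a≢b ∷ nl) h
  with restore-edge (deleteEdges-loops {G = G} loops (a≢b ∷ nl)) (deleteEdges-EdgeDeleted G D a≢b) h
... | h₁ , back₁ , cost₁ with restore loops nl h₁
... | h₂ , back₂ , cost₂ =
  h₂ , (λ v → ℤₚ.≤-trans (back₁ v) (back₂ v)) ,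
  subst (λ c → total h₂ ≤ total h + c) (sym (pos-2*suc (length D))) (≤-+-trans {k = total h} cost₂ cost₁)

occurrences : List (Fin n) → Fin n → ℤ
occurrences []      v = 0ℤ
occurrences (u ∷ U) v = 𝟙 ⌊ u ≟ v ⌋ + occurrences U v

consIf : {A : Set} → Bool → A → List A → List A
consIf true  x xs = x ∷ xs
consIf false x xs = xs

occurrences-consIf : ∀ c (x : Fin n) U v → occurrences (consIf c x U) v ≡ 𝟙 (c ∧ ⌊ x ≟ v ⌋) + occurrences U v
occurrences-consIf true  x U v = refl
occurrences-consIf false x U v = sym (ℤₚ.+-identityˡ _)

length-consIf : ∀ {A : Set} c (x : A) xs → length (consIf c x xs) ≡ (if c then 1 else 0) ℕ.+ length xs
length-consIf true  x xs = refl
length-consIf false x xs = refl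

-- Vertex a is listed once for each deleted edge {a,b} with f b = +1: the support a loses.
supportLosses : Opinion n → List (Edge n) → List (Fin n)
supportLosses f []            = []
supportLosses f ((a , b) ∷ D) = consIf (f b) a (consIf (f a) b (supportLosses f D))

edge-weight : ∀ x y → 2 ℕ.* ((if y then 1 else 0) ℕ.+ (if x then 1 else 0))
                    ≡ 4 ℕ.* (if x ∧ y then 1 else 0) ℕ.+ 2 ℕ.* (if (x ∧ not y) ∨ (not x ∧ y) then 1 else 0)
edge-weight true  true  = refl
edge-weight true  false = refl
edge-weight false true  = refl
edge-weight false false = refl

length-supportLosses : (f : Opinion n) (D : List (Edge n)) →
                       2 ℕ.* length (supportLosses f D) ≡ 4 ℕ.* countPP f D ℕ.+ 2 ℕ.* countPM f D
length-supportLosses f []            = refl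
length-supportLosses f ((a , b) ∷ D) = begin
  2 ℕ.* length (consIf (f b) a (consIf (f a) b U))
    ≡⟨ cong (2 ℕ.*_) (trans (length-consIf (f b) a _) (cong (i ℕ.+_) (length-consIf (f a) b U))) ⟩
  2 ℕ.* (i ℕ.+ (j ℕ.+ length U))
    ≡⟨ distrib i j (length U) ⟩
  2 ℕ.* (i ℕ.+ j) ℕ.+ 2 ℕ.* length U
    ≡⟨ cong₂ ℕ._+_ (edge-weight (f a) (f b)) (length-supportLosses f D) ⟩
  4 ℕ.* p ℕ.+ 2 ℕ.* q ℕ.+ (4 ℕ.* countPP f D ℕ.+ 2 ℕ.* countPM f D)
    ≡⟨ regroup p q (countPP f D) (countPM f D) ⟩
  4 ℕ.* (p ℕ.+ countPP f D) ℕ.+ 2 ℕ.* (q ℕ.+ countPM f D) ∎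
  where
  open ≡-Reasoning
  U = supportLosses f D
  i j p q : ℕ
  i = if f b then 1 else 0
  j = if f a then 1 else 0
  p = if f a ∧ f b then 1 else 0
  q = if (f a ∧ not (f b)) ∨ (not (f a) ∧ f b) then 1 else 0
  distrib : ∀ i j l → 2 ℕ.* (i ℕ.+ (j ℕ.+ l)) ≡ 2 ℕ.* (i ℕ.+ j) ℕ.+ 2 ℕ.* l
  distrib = ℕsolve-∀
  regroup : ∀ p q P M → 4 ℕ.* p ℕ.+ 2 ℕ.* q ℕ.+ (4 ℕ.* P ℕ.+ 2 ℕ.* M)
                      ≡ 4 ℕ.* (p ℕ.+ P) ℕ.+ 2 ℕ.* (q ℕ.+ M)
  regroup = ℕsolve-∀

summand-≤-𝟙 : ∀ c k y → summand (c ∧ k) y ≤ 𝟙 (y ∧ c)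
summand-≤-𝟙 false k     true  = +≤+ z≤n
summand-≤-𝟙 false k     false = +≤+ z≤n
summand-≤-𝟙 true  true  true  = ℤₚ.≤-refl
summand-≤-𝟙 true  true  false = -≤+
summand-≤-𝟙 true  false true  = +≤+ z≤n
summand-≤-𝟙 true  false false = +≤+ z≤n

EdgeDeleted-support : {K K′ : Graph n} {a b : Fin n} → EdgeDeleted K K′ a b → ∀ f v →
                      nbhdSum K f v ≤ nbhdSum K′ f v + (𝟙 (f b ∧ ⌊ a ≟ v ⌋) + 𝟙 (f a ∧ ⌊ b ≟ v ⌋))
EdgeDeleted-support {K = K} {K′} {a} {b} del f v =
  subst (_≤ _) (sym (nbhdSum-split del f v))
        (ℤₚ.+-monoʳ-≤ (nbhdSum K′ f v) (ℤₚ.+-mono-≤ (summand-≤-𝟙 ⌊ a ≟ v ⌋ (K v b) (f b))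
                                                     (summand-≤-𝟙 ⌊ b ≟ v ⌋ (K v a) (f a))))

support-lost : (G : Graph n) {D : List (Edge n)} → All (λ e → proj₁ e ≢ proj₂ e) D → ∀ f v →
               nbhdSum G f v ≤ nbhdSum (deleteEdges G D) f v + occurrences (supportLosses f D) v
support-lost G [] f v =
  ℤₚ.≤-reflexive (trans (sym (deleteEdges-[] G f v)) (sym (ℤₚ.+-identityʳ _)))
support-lost G {(a , b) ∷ D} (a≢b ∷ nl) f v = begin
  nbhdSum G f v
    ≤⟨ support-lost G nl f v ⟩
  nbhdSum K f v + occurrences U v
    ≤⟨ ℤₚ.+-monoˡ-≤ (occurrences U v) (EdgeDeleted-support (deleteEdges-EdgeDeleted G D a≢b) f v) ⟩
  nbhdSum K′ f v + (x + y) + occurrences U v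
    ≡⟨ assoc (nbhdSum K′ f v) x y (occurrences U v) ⟩
  nbhdSum K′ f v + (x + (y + occurrences U v))
    ≡⟨ cong (_+_ (nbhdSum K′ f v)) (sym (trans (occurrences-consIf (f b) a _ v)
                                                (cong (_+_ x) (occurrences-consIf (f a) b U v)))) ⟩
  nbhdSum K′ f v + occurrences (supportLosses f ((a , b) ∷ D)) v ∎
  where
  open ℤₚ.≤-Reasoning
  K  = deleteEdges G D
  K′ = deleteEdges G ((a , b) ∷ D)
  U  = supportLosses f D
  x = 𝟙 (f b ∧ ⌊ a ≟ v ⌋)
  y = 𝟙 (f a ∧ ⌊ b ≟ v ⌋)
  assoc : ∀ s x y o → s + (x + y) + o ≡ s + (x + (y + o))
  assoc = solve-∀

record Compensates (H : Graph n) (d : Fin n → ℤ) (h h′ : Opinion n) : Set where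
  field
    compensates : ∀ v → nbhdSum H h v + d v ≤ nbhdSum H h′ v ⊎ 0ℤ < nbhdSum H h′ v
open Compensates

opponent-or-positive : (H : Graph n) (h : Opinion n) (u : Fin n) → H u u ≡ true →
                       (∃ λ w → H u w ≡ true × h w ≡ false) ⊎ 0ℤ < nbhdSum H h u
opponent-or-positive H h u loop with any? (λ w → (H u w ≟ᵇ true) ×-dec (h w ≟ᵇ false))
... | yes opponent    = inj₁ opponent
... | no no-opponent =
  inj₂ (ℤₚ.suc[i]≤j⇒i<j (subst (_≤ nbhdSum H h u) (sumFin-at u (const 1ℤ)) (sumFin-mono loop-counts)))
  where
  loop-counts : ∀ w → (if ⌊ u ≟ w ⌋ then 1ℤ else 0ℤ) ≤ summand (H u w) (h w)
  loop-counts w with H u w in huw | h w in hw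
  ... | true  | false = ⊥-elim (no-opponent (w , huw , hw))
  ... | true  | true  with u ≟ w
  ...   | yes _ = ℤₚ.≤-refl
  ...   | no _  = +≤+ z≤n
  loop-counts w | false | _ with u ≟ w
  ...   | yes refl with () ← trans (sym loop) huw
  ...   | no _ = ℤₚ.≤-refl

Compensates-positive : {H : Graph n} {d : Fin n → ℤ} {h h′ : Opinion n} {u : Fin n} →
                       Compensates H d h h′ → 0ℤ < nbhdSum H h′ u →
                       Compensates H (λ v → 𝟙 ⌊ u ≟ v ⌋ + d v) h h′
Compensates-positive {H = H} {d} {h} {u = u} comp pos .compensates v with u ≟ v
... | yes refl = inj₂ pos
... | no _     =
  map₁ (ℤₚ.≤-trans (ℤₚ.≤-reflexive (cong (_+_ (nbhdSum H h v)) (ℤₚ.+-identityˡ (d v))))) (compensates comp v)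

Compensates-persuade : {H : Graph n} {d : Fin n → ℤ} {h h₁ : Opinion n} {u w : Fin n} →
                       Compensates H d h h₁ → H u w ≡ true → h₁ w ≡ false →
                       Compensates H (λ v → 𝟙 ⌊ u ≟ v ⌋ + d v) h (persuade h₁ w)
Compensates-persuade {H = H} {d} {h} {h₁} {u} {w} comp huw h₁w .compensates v with compensates comp v
... | inj₂ pos = inj₂ (ℤₚ.<-≤-trans pos (nbhdSum-persuade-mono h₁ h₁w H v))
... | inj₁ le  = inj₁ (begin
  nbhdSum H h v + (𝟙 ⌊ u ≟ v ⌋ + d v)            ≡⟨ swap (nbhdSum H h v) _ (d v) ⟩
  nbhdSum H h v + d v + 𝟙 ⌊ u ≟ v ⌋              ≤⟨ ℤₚ.+-mono-≤ le gain ⟩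
  nbhdSum H h₁ v + (if H v w then + 2 else 0ℤ)   ≡⟨ sym (nbhdSum-persuade h₁ h₁w H v) ⟩
  nbhdSum H (persuade h₁ w) v                    ∎)
  where
  open ℤₚ.≤-Reasoning
  swap : ∀ s i e → s + (i + e) ≡ s + e + i
  swap = solve-∀
  gain : 𝟙 ⌊ u ≟ v ⌋ ≤ (if H v w then + 2 else 0ℤ)
  gain with u ≟ v
  ... | yes refl rewrite huw = +≤+ (s≤s z≤n)
  ... | no _     = 0≤if-then-2 (H v w)

compensate-one : {H : Graph n} → (∀ v → H v v ≡ true) → {d : Fin n → ℤ} {h h₁ : Opinion n} (u : Fin n) →
                 Compensates H d h h₁ →
                 ∃ λ h′ → Compensates H (λ v → 𝟙 ⌊ u ≟ v ⌋ + d v) h h′ × total h′ ≤ total h₁ + + 2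
compensate-one {H = H} loops {h₁ = h₁} u comp with opponent-or-positive H h₁ u (loops u)
... | inj₂ pos               = h₁ , Compensates-positive comp pos , 0≤j⇒i≤i+j _ (+≤+ z≤n)
... | inj₁ (w , huw , h₁w) = persuade h₁ w , Compensates-persuade comp huw h₁w ,
                              ℤₚ.≤-reflexive (total-persuade h₁ h₁w)

compensate : {H : Graph n} → (∀ v → H v v ≡ true) → ∀ h U →
             ∃ λ h′ → Compensates H (occurrences U) h h′ × total h′ ≤ total h + + (2 ℕ.* length U)
compensate loops h []      =
  h , record { compensates = λ v → inj₁ (ℤₚ.≤-reflexive (ℤₚ.+-identityʳ _)) } , 0≤j⇒i≤i+j _ (+≤+ z≤n)
compensate loops h (u ∷ U) with compensate loops h U
... | h₁ , comp₁ , cost₁ with compensate-one loops u comp₁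
... | h′ , comp′ , cost′ =
  h′ , comp′ ,
  subst (λ c → total h′ ≤ total h + c) (sym (trans (pos-2*suc (length U)) (ℤₚ.+-comm (+ 2) (+ (2 ℕ.* length U)))))
        (≤-+-trans {k = total h} cost′ cost₁)

compensated-positivity : {K H : Graph n} {d : Fin n → ℤ} {f h : Opinion n} →
                         (∀ v → nbhdSum K f v ≤ nbhdSum H f v + d v) → Compensates H d f h →
                         ∀ v → 0ℤ < nbhdSum K f v → 0ℤ < nbhdSum H h v
compensated-positivity deficit comp v pos with compensates comp v
... | inj₁ le    = ℤₚ.<-≤-trans pos (ℤₚ.≤-trans (deficit v) le)
... | inj₂ pos′ = pos′

strictDomNumber-≤-restored : {G : Graph n} → (∀ v → G v v ≡ true) →
                             {D : List (Edge n)} → All (λ e → proj₁ e ≢ proj₂ e) D →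
                             ∀ {γG γH} → IsStrictDomNumber G γG → IsStrictDomNumber (deleteEdges G D) γH →
                             γG ≤ γH + + (2 ℕ.* length D)
strictDomNumber-≤-restored {G = G} loops {D} nonloops {γG} {γH} (_ , γG-min) ((hH , maj-hH , total-hH) , _)
  with restore {G = G} loops nonloops hH
... | h , back , cost = begin
  γG                               ≤⟨ γG-min h maj-h ⟩
  total h                          ≤⟨ cost ⟩
  total hH + + (2 ℕ.* length D)   ≡⟨ cong (_+ + (2 ℕ.* length D)) total-hH ⟩
  γH + + (2 ℕ.* length D)         ∎
  where
  open ℤₚ.≤-Reasoning
  maj-h = majority-transfer {K = deleteEdges G D} {G} {hH} {h} (λ v pos → ℤₚ.<-≤-trans pos (back v)) maj-hH

deleteEdges-strictDomNumber-≤ : {G : Graph n} → (∀ v → G v v ≡ true) →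
                                {D : List (Edge n)} → All (λ e → proj₁ e ≢ proj₂ e) D →
                                ∀ {f γH} → StrictlyMajoritarian G f → IsStrictDomNumber (deleteEdges G D) γH →
                                γH ≤ total f + + (4 ℕ.* countPP f D ℕ.+ 2 ℕ.* countPM f D)
deleteEdges-strictDomNumber-≤ {G = G} loops {D} nonloops {f} {γH} maj-f (_ , γH-min)
  with compensate {H = deleteEdges G D} (deleteEdges-loops {G = G} loops nonloops) f (supportLosses f D)
... | h , comp , cost = begin
  γH                                              ≤⟨ γH-min h maj-h ⟩
  total h                                         ≤⟨ cost ⟩
  total f + + (2 ℕ.* length (supportLosses f D))  ≡⟨ cong (λ c → total f + + c) (length-supportLosses f D) ⟩
  total f + + (4 ℕ.* countPP f D ℕ.+ 2 ℕ.* countPM f D) ∎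
  where
  open ℤₚ.≤-Reasoning
  maj-h = majority-transfer {K = G} {deleteEdges G D} {f} {h}
            (compensated-positivity {K = G} {f = f} (support-lost G nonloops f) comp) maj-f

theorem2 : (n : ℕ) (G : Graph (suc n)) → IsLoopedGraph G →
           (f : Opinion (suc n)) → Optimal G f →
           (D : List (Edge (suc n))) → ValidDeletion G D →
           (γG γH : ℤ) → IsStrictDomNumber G γG →
           IsStrictDomNumber (deleteEdges G D) γH →
           (- (+ (4 ℕ.* countPP f D ℕ.+ 2 ℕ.* countPM f D)) ≤ γG - γH)
           × (γG - γH ≤ + (2 ℕ.* length D))
theorem2 n G isG f (maj-f , optimal-f) D (edges , _) γG γH γG-spec γH-spec =
  j≤i+k⇒-k≤i-j {γG} {γH} lower , i≤j+k⇒i-j≤k {γG} {γH} upper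
  where
  loops = IsLoopedGraph.loops isG
  nonloops = All.map proj₁ edges
  lower = subst (λ t → γH ≤ t + _) (optimal-f γG γG-spec)
                (deleteEdges-strictDomNumber-≤ {G = G} loops nonloops {f} maj-f γH-spec)
  upper = strictDomNumber-≤-restored {G = G} loops nonloops γG-spec γH-spec
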